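{- Let $n\ge k\ge s\ge1$ be integers and let $\mathcal A,\mathcal B\subset\binom{[n]}{k}$ be $s$-cross-intersecting families. If $T_1\in\binom{[n]}{s}$ is a kernel for $\mathcal A$ and $T_2\in\binom{[n]}{s}$ is a kernel for $\mathcal B$, then $T_1=T_2$.
   Context: Families $\mathcal A,\mathcal B$ are $s$-cross-intersecting if $|A\cap B|\ge s$ for all $A\in\mathcal A,B\in\mathcal B$. For a family $\mathcal S\subset\binom{[n]}{k}$ and a set $T$, let $\mathcal S(T)=\{S\setminus T: S\in\mathcal S,\ S\supset T\}$. A set $T\in\binom{[n]}{s}$ is called a kernel for $\mathcal S$ if $\mathcal S(T)$ contains $k+1$ pairwise disjoint sets. -}

module Defs where

open import Data.Nat using (ℕ; suc; _≤_)
open import Data.Fin using (Fin)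
open import Data.Fin.Subset using (Subset; _∩_; _─_; _⊆_; ∣_∣; Empty)
open import Data.Product using (Σ; ∃; _×_)
open import Relation.Binary.PropositionalEquality using (_≡_)
open import Relation.Nullary using (¬_)

Family : ℕ → Set₁
Family n = Subset n → Set

Uniform : ∀ {n} → ℕ → Family n → Set
Uniform k 𝒮 = ∀ S → 𝒮 S → ∣ S ∣ ≡ k

CrossIntersecting : ∀ {n} → ℕ → Family n → Family n → Set
CrossIntersecting s 𝒜 ℬ = ∀ A B → 𝒜 A → ℬ B → s ≤ ∣ A ∩ B ∣

Link : ∀ {n} → Family n → Subset n → Family n
Link 𝒮 T X = Σ (Subset _) (λ S → 𝒮 S × T ⊆ S × X ≡ S ─ T)

Disjoint : ∀ {n} → Subset n → Subset n → Set
Disjoint X Y = Empty (X ∩ Y)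

-- T is a kernel for 𝒮 (with uniformity k): 𝒮(T) contains k+1 pairwise
-- disjoint sets (k+1 distinct sets, indexed injectively by Fin (k+1)).
Kernel : ∀ {n} → ℕ → Family n → Subset n → Set
Kernel k 𝒮 T =
  Σ (Fin (suc k) → Subset _) (λ F →
    (∀ i j → F i ≡ F j → i ≡ j) ×
    (∀ i → Link 𝒮 T (F i)) ×
    (∀ i j → ¬ i ≡ j → Disjoint (F i) (F j)))

-- Every set B of ℬ has |B| = k and meets each set of 𝒜 in at least s = |T₁| points.
-- If T₁ ⊄ B, then |T₁ ∩ B| < s, so each of the k+1 disjoint sets Aᵢ ∖ T₁ of the
-- kernel of T₁ contains a point of B, giving k+1 distinct points in B: impossible.
-- Hence T₁ lies in every set of ℬ, in particular in two sets of the kernel of T₂,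
-- whose differences with T₂ are disjoint; so T₁ ⊆ T₂, and equal sizes give T₁ = T₂.
module Submission where

open import Defs
open import Data.Nat using (ℕ; zero; suc; _≤_; _<_; s≤s; z≤n)
open import Data.Nat.Properties using (≤-<-trans; <-≤-trans; ≤-trans; ≤-reflexive; <⇒≱; ≮⇒≥)
open import Data.Fin using (Fin; zero; suc)
open import Data.Fin.Properties using (suc-injective)
open import Data.Fin.Subset using (Subset; _∈_; _∉_; _⊆_; _∩_; _─_; _-_; ∣_∣; Nonempty; outside; inside)
open import Data.Fin.Subset.Properties
open import Data.Vec using (_∷_; here; there)
open import Data.Product using (_,_; proj₁; proj₂)
open import Relation.Nullary using (¬_; yes; no; contradiction)
open import Relation.Binary.PropositionalEquality using (_≡_; _≢_; sym; trans; subst)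

x∈p─q⇒x∉q : ∀ {n} {x : Fin n} (p q : Subset n) → x ∈ p ─ q → x ∉ q
x∈p─q⇒x∉q (inside ∷ p) (outside ∷ q) here       ()
x∈p─q⇒x∉q (_      ∷ p) (_       ∷ q) (there x∈) (there x∈q) = x∈p─q⇒x∉q p q x∈ x∈q

∣q∣<∣p∣⇒Nonempty[p─q] : ∀ {n} (p q : Subset n) → ∣ q ∣ < ∣ p ∣ → Nonempty (p ─ q)
∣q∣<∣p∣⇒Nonempty[p─q] p q ∣q∣<∣p∣ with nonempty? (p ─ q)
... | yes nonempty = nonempty
... | no  empty    = contradiction (p⊆q⇒∣p∣≤∣q∣ p⊆q) (<⇒≱ ∣q∣<∣p∣)
  where
  p⊆q : p ⊆ q
  p⊆q {x} x∈p with x ∈? q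
  ... | yes x∈q = x∈q
  ... | no  x∉q = contradiction (x , x∈p∧x∉q⇒x∈p─q x∈p x∉q) empty

p⊆q∧∣q∣≤∣p∣⇒p≡q : ∀ {n} {p q : Subset n} → p ⊆ q → ∣ q ∣ ≤ ∣ p ∣ → p ≡ q
p⊆q∧∣q∣≤∣p∣⇒p≡q {p = p} {q} p⊆q ∣q∣≤∣p∣ = ⊆-antisym p⊆q q⊆p
  where
  q⊆p : q ⊆ p
  q⊆p {x} x∈q with x ∈? p
  ... | yes x∈p = x∈p
  ... | no  x∉p = contradiction ∣q∣≤∣p∣ (<⇒≱ (p⊂q⇒∣p∣<∣q∣ (p⊆q , x , x∈q , x∉p)))

∣p∣≤∣p∩q∣⇒p⊆q : ∀ {n} (p q : Subset n) → ∣ p ∣ ≤ ∣ p ∩ q ∣ → p ⊆ q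
∣p∣≤∣p∩q∣⇒p⊆q p q ∣p∣≤∣p∩q∣ x∈p =
  proj₂ (x∈p∩q⁻ p q (subst (_ ∈_) (sym p∩q≡p) x∈p))
  where
  p∩q≡p : p ∩ q ≡ p
  p∩q≡p = p⊆q∧∣q∣≤∣p∣⇒p≡q (p∩q⊆p p q) ∣p∣≤∣p∩q∣

distinct-members⇒≤∣p∣ : ∀ {n} m (f : Fin m → Fin n) (p : Subset n) →
                        (∀ i j → i ≢ j → f i ≢ f j) → (∀ i → f i ∈ p) → m ≤ ∣ p ∣
distinct-members⇒≤∣p∣ zero    f p distinct f∈p = z≤n
distinct-members⇒≤∣p∣ (suc m) f p distinct f∈p =
  ≤-<-trans (distinct-members⇒≤∣p∣ m (λ i → f (suc i)) (p - f zero) distinct-tail f-tail∈)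
            (x∈p⇒∣p-x∣<∣p∣ (f∈p zero))
  where
  distinct-tail : ∀ i j → i ≢ j → f (suc i) ≢ f (suc j)
  distinct-tail i j i≢j = distinct (suc i) (suc j) (λ si≡sj → i≢j (suc-injective si≡sj))
  f-tail∈ : ∀ i → f (suc i) ∈ p - f zero
  f-tail∈ i = x∈p∧x≢y⇒x∈p-y (f∈p (suc i)) (distinct (suc i) zero λ ())

kernel⊆cross-intersector : ∀ {n k} {𝒜 : Family n} {T B : Subset n} → Kernel k 𝒜 T → ∣ B ∣ ≤ k →
                           (∀ A → 𝒜 A → ∣ T ∣ ≤ ∣ A ∩ B ∣) → T ⊆ B
kernel⊆cross-intersector {k = k} {T = T} {B} (F , _ , link , disjoint) ∣B∣≤k meets =
  ∣p∣≤∣p∩q∣⇒p⊆q T B (≮⇒≥ ∣T∩B∣≮∣T∣)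
  where
  ∣T∩B∣≮∣T∣ : ¬ ∣ T ∩ B ∣ < ∣ T ∣
  ∣T∩B∣≮∣T∣ ∣T∩B∣<∣T∣ = <⇒≱ (s≤s ∣B∣≤k) (distinct-members⇒≤∣p∣ (suc k) y B y-distinct y∈B)
    where
    A : Fin (suc k) → Subset _
    A i = proj₁ (link i)
    point : ∀ i → Nonempty ((A i ∩ B) ─ (T ∩ B))
    point i = ∣q∣<∣p∣⇒Nonempty[p─q] (A i ∩ B) (T ∩ B)
                (<-≤-trans ∣T∩B∣<∣T∣ (meets (A i) (proj₁ (proj₂ (link i)))))
    y : Fin (suc k) → Fin _
    y i = proj₁ (point i)
    y∈A∩B : ∀ i → y i ∈ A i ∩ B
    y∈A∩B i = p─q⊆p (A i ∩ B) (T ∩ B) (proj₂ (point i))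
    y∈B : ∀ i → y i ∈ B
    y∈B i = proj₂ (x∈p∩q⁻ (A i) B (y∈A∩B i))
    y∉T : ∀ i → y i ∉ T
    y∉T i y∈T = x∈p─q⇒x∉q (A i ∩ B) (T ∩ B) (proj₂ (point i)) (x∈p∩q⁺ (y∈T , y∈B i))
    y∈F : ∀ i → y i ∈ F i
    y∈F i = subst (y i ∈_) (sym (proj₂ (proj₂ (proj₂ (link i)))))
              (x∈p∧x∉q⇒x∈p─q (proj₁ (x∈p∩q⁻ (A i) B (y∈A∩B i))) (y∉T i))
    y-distinct : ∀ i j → i ≢ j → y i ≢ y j
    y-distinct i j i≢j yi≡yj =
      disjoint i j i≢j (y i , x∈p∩q⁺ (y∈F i , subst (_∈ F j) (sym yi≡yj) (y∈F j)))

⊆-members⇒⊆-kernel : ∀ {n k} {ℬ : Family n} {T X : Subset n} → Kernel k ℬ T → 1 ≤ k →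
                     (∀ B → ℬ B → X ⊆ B) → X ⊆ T
⊆-members⇒⊆-kernel {T = T} (G , _ , link , disjoint) (s≤s _) X⊆members {x} x∈X with x ∈? T
... | yes x∈T = x∈T
... | no  x∉T =
  contradiction (x , x∈p∩q⁺ (x∈G zero , x∈G (suc zero))) (disjoint zero (suc zero) λ ())
  where
  x∈G : ∀ j → x ∈ G j
  x∈G j with link j
  ... | B , B∈ℬ , _ , Gj≡B─T =
    subst (x ∈_) (sym Gj≡B─T) (x∈p∧x∉q⇒x∈p─q (X⊆members B B∈ℬ x∈X) x∉T)

lemma12 : (n k s : ℕ) → 1 ≤ s → s ≤ k → k ≤ n →
          (𝒜 ℬ : Family n) → Uniform k 𝒜 → Uniform k ℬ →
          CrossIntersecting s 𝒜 ℬ →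
          (T₁ T₂ : Subset n) → ∣ T₁ ∣ ≡ s → ∣ T₂ ∣ ≡ s →
          Kernel k 𝒜 T₁ → Kernel k ℬ T₂ → T₁ ≡ T₂
lemma12 n k s 1≤s s≤k _ 𝒜 ℬ _ uniformℬ cross T₁ T₂ ∣T₁∣≡s ∣T₂∣≡s kernel₁ kernel₂ =
  p⊆q∧∣q∣≤∣p∣⇒p≡q T₁⊆T₂ (≤-reflexive (trans ∣T₂∣≡s (sym ∣T₁∣≡s)))
  where
  T₁⊆members : ∀ B → ℬ B → T₁ ⊆ B
  T₁⊆members B B∈ℬ = kernel⊆cross-intersector kernel₁ (≤-reflexive (uniformℬ B B∈ℬ))
    (λ A A∈𝒜 → subst (_≤ ∣ A ∩ B ∣) (sym ∣T₁∣≡s) (cross A B A∈𝒜 B∈ℬ))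
  T₁⊆T₂ : T₁ ⊆ T₂
  T₁⊆T₂ = ⊆-members⇒⊆-kernel kernel₂ (≤-trans 1≤s s≤k) T₁⊆members
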